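{- Let $\mathsf{T}$ be a rooted plane tree and let $(\lambda,\varrho)\lessdot(\lambda',\varrho')$ be a cover relation in $\Theta(\mathsf{T}^\times)$. Then either $(\lambda,\varrho)$ and $(\lambda',\varrho')$ are related by a permutohedron move, or they are related by an associahedron move.
   Context: A rooted plane tree $\mathsf{T}$ with $n+1$ vertices is viewed as a poset $\leq_\mathsf{T}$ on its vertex set with the root as unique minimum and each non-root vertex covering exactly its parent; vertices are identified with $\{0,\ldots,n\}$ so that $0,1,\ldots,n$ is the preorder traversal (root first, then the subtrees of the root, each recursively in preorder, left to right). $\mathsf{T}^\times$ is the forest poset on $[n]$ obtained by deleting the root $0$. An ornament is a subset of $[n]$ inducing a connected subgraph of $\mathsf{T}^\times$, hung at its minimal element. An ornamentation is a function $\varrho$ from $[n]$ to ornaments with $\varrho(v)$ hung at $v$ and any two $\varrho(v),\varrho(v')$ nested or disjoint; $\mathcal O(\mathsf{T}^\times)$ is ordered by $\varrho\leq\varrho'$ iff $\varrho(v)\subseteq\varrho'(v)$ for all $v$. $\mathcal L(\mathsf{T}^\times)$ is the set of linear extensions of $\mathsf{T}^\times$, i.e., permutations $\lambda$ of $[n]$ in one-line notation such that $x<_\mathsf{T}y$ implies $x$ precedes $y$; it is ordered by the weak order ($\lambda\leq\lambda'$ iff the inversion set of $\lambda$ is contained in that of $\lambda'$, an inversion of $w$ being a pair $(i,j)$, $i<j$, with $j$ appearing before $i$). For a word $\lambda$ and set $S$, $\lambda|_S$ is the subword of entries in $S$; $S$ forms a consecutive factor if its elements occupy consecutive positions. $\Theta(\mathsf{T}^\times)$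 is the set of pairs $(\lambda,\varrho)\in\mathcal L(\mathsf{T}^\times)\times\mathcal O(\mathsf{T}^\times)$ with each $\varrho(v)$ forming a consecutive factor of $\lambda$, ordered by $(\lambda,\varrho)\leq(\lambda',\varrho')$ iff $\lambda\leq\lambda'$ and $\varrho\leq\varrho'$. A cover relation $(\lambda,\varrho)\lessdot(\lambda',\varrho')$ is a permutohedron move if $\varrho=\varrho'$ and there exist $p,q\in[n]$ incomparable in $\mathsf{T}$ such that every number in $\varrho(p)$ is less than every number in $\varrho(q)$, $\lambda|_{\varrho(p)}\lambda|_{\varrho(q)}$ is a consecutive factor of $\lambda$, and $\lambda'$ is obtained from $\lambda$ by swapping $\lambda|_{\varrho(p)}$ and $\lambda|_{\varrho(q)}$. It is an associahedron move if $\lambda=\lambda'$ and there is $t\in[n]$ such that $\varrho(v)=\varrho'(v)$ for all $v\neq t$ and $\varrho'(t)=\varrho(t)\cup\varrho(t^\to)$, where $t^\to$ is the entry of $\lambda$ immediately after the consecutive factor $\lambda|_{\varrho(t)}$. -}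

module Defs where

open import Data.Nat using (ℕ; zero; suc; _+_; _≤_; _<_)
open import Data.Bool using (Bool; true; false; _∨_)
open import Data.List using (List; []; _∷_; _++_; map; upTo)
open import Data.List.Membership.Propositional using (_∈_)
open import Data.List.Relation.Binary.Permutation.Propositional using (_↭_)
open import Data.Product using (_×_; _,_; Σ; ∃; ∃-syntax)
open import Data.Sum using (_⊎_)
open import Relation.Nullary using (¬_)
open import Relation.Binary.PropositionalEquality using (_≡_; _≢_)
open import Relation.Binary.Construct.Closure.ReflexiveTransitive using (Star)
open import Function.Bundles using (_⇔_)

-- Rooted plane trees; vertices labelled 0..n in preorder.

data PTree : Set where
  node : List PTree → PTree

mutual
  size : PTree → ℕ
  size (node ts) = suc (sizes ts)

  sizes : List PTree → ℕ
  sizes [] = 0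
  sizes (t ∷ ts) = size t + sizes ts

mutual
  -- edges (parent , child) of a tree whose root has preorder label o
  edgesT : ℕ → PTree → List (ℕ × ℕ)
  edgesT o (node ts) = edgesF o (suc o) ts

  -- edges for a forest of children of parent p, first child's root labelled c
  edgesF : ℕ → ℕ → List PTree → List (ℕ × ℕ)
  edgesF p c [] = []
  edgesF p c (t ∷ ts) = (p , c) ∷ (edgesT c t ++ edgesF p (c + size t) ts)

-- number of non-root vertices: T has n+1 vertices
nOf : PTree → ℕ
nOf (node ts) = sizes ts

Parent : PTree → ℕ → ℕ → Set
Parent T x y = (x , y) ∈ edgesT 0 T

_≤[_]_ : ℕ → PTree → ℕ → Set
x ≤[ T ] y = Star (Parent T) x y

InN : ℕ → ℕ → Set
InN n x = 1 ≤ x × x ≤ n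

range : ℕ → List ℕ
range n = map suc (upTo n)

Sub : Set
Sub = ℕ → Bool

_∈S_ : ℕ → Sub → Set
x ∈S S = S x ≡ true

_⊆S_ : Sub → Sub → Set
S ⊆S S' = ∀ x → x ∈S S → x ∈S S'

_≈S_ : Sub → Sub → Set
S ≈S S' = ∀ x → S x ≡ S' x

_∪S_ : Sub → Sub → Sub
(S ∪S S') x = S x ∨ S' x

DisjointS : Sub → Sub → Set
DisjointS S S' = ∀ x → x ∈S S → x ∈S S' → Data.Empty.⊥
  where import Data.Empty

restrict : Sub → List ℕ → List ℕ
restrict S [] = []
restrict S (x ∷ xs) with S x
... | true = x ∷ restrict S xs
... | false = restrict S xs

ConsecFactor : Sub → List ℕ → Set
ConsecFactor S w = ∃[ A ] ∃[ B ] ∃[ C ] (w ≡ A ++ B ++ C × (∀ x → (x ∈ B) ⇔ (x ∈S S)))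

-- adjacency in the forest T^× restricted to the vertices in S
-- (S ⊆ [n], so the root 0 is never used)
AdjIn : PTree → Sub → ℕ → ℕ → Set
AdjIn T S a b = a ∈S S × b ∈S S × (Parent T a b ⊎ Parent T b a)

OrnamentAt : PTree → ℕ → Sub → Set
OrnamentAt T v S =
    (∀ x → x ∈S S → InN (nOf T) x)
  × (∀ x y → x ∈S S → y ∈S S → Star (AdjIn T S) x y)
  × v ∈S S × (∀ x → x ∈S S → v ≤[ T ] x)

Ornamentation : Set
Ornamentation = ℕ → Sub

IsOrnamentation : PTree → Ornamentation → Set
IsOrnamentation T ϱ =
    (∀ v → InN (nOf T) v → OrnamentAt T v (ϱ v))
  × (∀ v v' → InN (nOf T) v → InN (nOf T) v' →
       (ϱ v ⊆S ϱ v') ⊎ (ϱ v' ⊆S ϱ v) ⊎ DisjointS (ϱ v) (ϱ v'))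
  where import Data.Empty

-- order and equality on ornamentations (only values on [n] matter)
_≤O[_]_ : Ornamentation → PTree → Ornamentation → Set
ϱ ≤O[ T ] ϱ' = ∀ v → InN (nOf T) v → ϱ v ⊆S ϱ' v

_≈O[_]_ : Ornamentation → PTree → Ornamentation → Set
ϱ ≈O[ T ] ϱ' = ∀ v → InN (nOf T) v → ϱ v ≈S ϱ' v

Precedes : List ℕ → ℕ → ℕ → Set
Precedes w x y = ∃[ A ] ∃[ B ] (w ≡ A ++ x ∷ B × y ∈ B)

IsLinExt : PTree → List ℕ → Set
IsLinExt T w =
    (w ↭ range (nOf T))
  × (∀ x y → InN (nOf T) x → InN (nOf T) y → x ≤[ T ] y → x ≢ y → Precedes w x y)

Inv : List ℕ → ℕ → ℕ → Set
Inv w i j = i < j × Precedes w j i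

_≤W_ : List ℕ → List ℕ → Set
w ≤W w' = ∀ i j → Inv w i j → Inv w' i j

InTheta : PTree → List ℕ → Ornamentation → Set
InTheta T w ϱ = IsLinExt T w × IsOrnamentation T ϱ
              × (∀ v → InN (nOf T) v → ConsecFactor (ϱ v) w)

ThetaLe : PTree → List ℕ → Ornamentation → List ℕ → Ornamentation → Set
ThetaLe T w ϱ w' ϱ' = w ≤W w' × ϱ ≤O[ T ] ϱ'

ThetaEq : PTree → List ℕ → Ornamentation → List ℕ → Ornamentation → Set
ThetaEq T w ϱ w' ϱ' = w ≡ w' × ϱ ≈O[ T ] ϱ'

ThetaLt : PTree → List ℕ → Ornamentation → List ℕ → Ornamentation → Set
ThetaLt T w ϱ w' ϱ' = ThetaLe T w ϱ w' ϱ' × ¬ ThetaEq T w ϱ w' ϱ'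

Covers : PTree → List ℕ → Ornamentation → List ℕ → Ornamentation → Set
Covers T w ϱ w' ϱ' =
    ThetaLt T w ϱ w' ϱ'
  × (∀ w'' ϱ'' → InTheta T w'' ϱ'' →
       ¬ (ThetaLt T w ϱ w'' ϱ'' × ThetaLt T w'' ϱ'' w' ϱ'))

PermMove : PTree → List ℕ → Ornamentation → List ℕ → Ornamentation → Set
PermMove T w ϱ w' ϱ' =
    ϱ ≈O[ T ] ϱ'
  × ∃[ p ] ∃[ q ] (InN (nOf T) p × InN (nOf T) q
      × ¬ (p ≤[ T ] q) × ¬ (q ≤[ T ] p)
      × (∀ x y → x ∈S ϱ p → y ∈S ϱ q → x < y)
      × ∃[ A ] ∃[ C ]
          (w ≡ A ++ restrict (ϱ p) w ++ restrict (ϱ q) w ++ C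
         × w' ≡ A ++ restrict (ϱ q) w ++ restrict (ϱ p) w ++ C))

AssocMove : PTree → List ℕ → Ornamentation → List ℕ → Ornamentation → Set
AssocMove T w ϱ w' ϱ' =
    w ≡ w'
  × ∃[ t ] (InN (nOf T) t
      × (∀ v → InN (nOf T) v → v ≢ t → ϱ v ≈S ϱ' v)
      × ∃[ A ] ∃[ C ] ∃[ u ]
          (w ≡ A ++ restrict (ϱ t) w ++ u ∷ C
         × ϱ' t ≈S (ϱ t ∪S ϱ u)))

module Submission where

-- Let (w, ϱ) ⋖ (w′, ϱ′) and pick adjacent letters x y of w: if w ≠ w′, a pair that w′ inverts; if w = w′,
-- the last letter x of a factor ϱ v that grows in ϱ′, and the letter y after it. Let P = ϱ p be the largest
-- ornament containing x but not y, and Q = ϱ q the largest one containing y but not x. Then Q begins at its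
-- root q = y, so w = A P Q C, and every other ornament lies inside P, inside Q, contains both or misses both.
-- Hence merging Q into P (when q ∈ ϱ′ p), or else swapping the factors P and Q, yields an element of Θ
-- strictly above (w, ϱ) and below (w′, ϱ′). By the cover property it is (w′, ϱ′): an associahedron,
-- respectively a permutohedron, move.

open import Defs
open import Data.Bool using (true; false)
import Data.Bool.Properties as Bool
open import Data.Empty using (⊥; ⊥-elim)
open import Data.List using (List; []; _∷_; _++_; [_]; _∷ʳ_; _∷ʳ′_; initLast)
open import Data.List.Properties using (++-assoc; ++-identityʳ)
import Data.List.Properties as List
open import Data.List.Membership.Propositional using (_∈_; _∉_; find)
open import Data.List.Membership.Propositional.Properties
  using (∈-++⁻; ∈-++⁺ˡ; ∈-++⁺ʳ; ∈-∃++; ∈-map⁺; ∈-map⁻; ∈-upTo⁺; ∈-upTo⁻)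
open import Data.List.Relation.Unary.All using (all?) renaming (lookup to All-lookup)
open import Data.List.Relation.Unary.All.Properties using (¬All⇒Any¬)
open import Data.List.Relation.Unary.Any using (here; there)
open import Data.List.Relation.Unary.Unique.Propositional using (Unique)
import Data.List.Relation.Unary.Unique.Propositional as Unique
open import Data.List.Relation.Unary.Unique.Propositional.Properties using (Unique[x∷xs]⇒x∉xs; map⁺; upTo⁺)
open import Data.List.Relation.Binary.Permutation.Propositional using (_↭_; ↭-sym; ↭-trans; ↭⇒↭ₛ)
open import Data.List.Relation.Binary.Permutation.Propositional.Properties using (∈-resp-↭; ++⁺ˡ; shifts)
import Data.List.Relation.Binary.Permutation.Setoid.Properties as ↭ₛ
open import Data.Nat using (ℕ; suc; _+_; _≤_; _<_; s≤s; z≤n; _≟_; _≤?_)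
open import Data.Nat.Properties
  using (≤-refl; ≤-trans; ≤-antisym; <⇒≤; <⇒≢; <-≤-trans; m≤m+n; n<1+n; <-cmp; <-asym; suc-injective)
open import Data.Product using (_×_; _,_; ∃-syntax; proj₁; proj₂)
open import Data.Sum using (_⊎_; inj₁; inj₂; [_,_]′)
open import Function.Bundles using (_⇔_; Equivalence; mk⇔)
open import Relation.Binary.Construct.Closure.ReflexiveTransitive using (Star; ε; _◅_; _◅◅_)
import Relation.Binary.Construct.Closure.ReflexiveTransitive as Star
open import Relation.Binary.Definitions using (tri<; tri≈; tri>)
open import Relation.Binary.PropositionalEquality
  using (_≡_; _≢_; refl; sym; trans; cong; cong₂; subst; setoid; module ≡-Reasoning)
open import Relation.Nullary using (¬_; Dec; yes; no; ¬?; _×-dec_)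

open Equivalence using (to; from)

-- Tree order

mutual
  edgesT-increasing : ∀ o t {a b} → (a , b) ∈ edgesT o t → a < b
  edgesT-increasing o (node ts) = edgesF-increasing o (suc o) ts (n<1+n o)

  edgesF-increasing : ∀ p c ts {a b} → p < c → (a , b) ∈ edgesF p c ts → a < b
  edgesF-increasing p c (t ∷ ts) p<c (here refl) = p<c
  edgesF-increasing p c (t ∷ ts) p<c (there e) with ∈-++⁻ (edgesT c t) e
  ... | inj₁ e′ = edgesT-increasing c t e′
  ... | inj₂ e′ = edgesF-increasing p (c + size t) ts (<-≤-trans p<c (m≤m+n c (size t))) e′

parent⇒< : ∀ T {a b} → Parent T a b → a < b
parent⇒< T = edgesT-increasing 0 T

≤T⇒≤ : ∀ T {a b} → a ≤[ T ] b → a ≤ b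
≤T⇒≤ T ε = ≤-refl
≤T⇒≤ T (e ◅ s) = ≤-trans (<⇒≤ (parent⇒< T e)) (≤T⇒≤ T s)

≤T-antisym : ∀ T {a b} → a ≤[ T ] b → b ≤[ T ] a → a ≡ b
≤T-antisym T s t = ≤-antisym (≤T⇒≤ T s) (≤T⇒≤ T t)

≤T-parent-of-last : ∀ T {a b} → a ≤[ T ] b → a ≢ b → ∃[ g ] (a ≤[ T ] g × Parent T g b)
≤T-parent-of-last T ε a≢b = ⊥-elim (a≢b refl)
≤T-parent-of-last T {a} {b} (_◅_ {j = c} e s) a≢b with c ≟ b
... | yes refl = a , ε , e
... | no c≢b with ≤T-parent-of-last T s c≢b
... | g , s′ , e′ = g , e ◅ s′ , e′

-- Precedence in duplicate-free words

Unique-++⁻ʳ : ∀ X {Y : List ℕ} → Unique (X ++ Y) → Unique Y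
Unique-++⁻ʳ [] u = u
Unique-++⁻ʳ (c ∷ X) u = Unique-++⁻ʳ X (Unique.tail u)

Unique-++⇒disjoint : ∀ X {Y} {a : ℕ} → Unique (X ++ Y) → a ∈ X → a ∉ Y
Unique-++⇒disjoint (c ∷ X) u (here refl) a∈Y = Unique[x∷xs]⇒x∉xs u (∈-++⁺ʳ X a∈Y)
Unique-++⇒disjoint (c ∷ X) u (there a∈X) a∈Y = Unique-++⇒disjoint X (Unique.tail u) a∈X a∈Y

Unique-resp-↭ : ∀ {xs ys : List ℕ} → xs ↭ ys → Unique xs → Unique ys
Unique-resp-↭ p = ↭ₛ.Unique-resp-↭ (setoid ℕ) (↭⇒↭ₛ p)

Precedes⇒∈ˡ : ∀ {w a b} → Precedes w a b → a ∈ w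
Precedes⇒∈ˡ (A , B , refl , _) = ∈-++⁺ʳ A (here refl)

Precedes⇒∈ʳ : ∀ {w a b} → Precedes w a b → b ∈ w
Precedes⇒∈ʳ (A , B , refl , b∈B) = ∈-++⁺ʳ A (there b∈B)

¬Precedes-[] : ∀ {a b} → ¬ Precedes [] a b
¬Precedes-[] ([] , _ , () , _)
¬Precedes-[] (_ ∷ _ , _ , () , _)

Precedes-head : ∀ {c w b} → b ∈ w → Precedes (c ∷ w) c b
Precedes-head b∈w = [] , _ , refl , b∈w

Precedes-∷⁺ : ∀ {c w a b} → Precedes w a b → Precedes (c ∷ w) a b
Precedes-∷⁺ (A , B , refl , b∈B) = _ ∷ A , B , refl , b∈B

Precedes-∷⁻ : ∀ {c w a b} → Precedes (c ∷ w) a b → (a ≡ c × b ∈ w) ⊎ Precedes w a b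
Precedes-∷⁻ ([] , B , refl , b∈B) = inj₁ (refl , b∈B)
Precedes-∷⁻ (d ∷ A , B , refl , b∈B) = inj₂ (A , B , refl , b∈B)

Precedes-asym : ∀ {w a b} → Unique w → Precedes w a b → ¬ Precedes w b a
Precedes-asym {[]} u p q = ¬Precedes-[] p
Precedes-asym {c ∷ w} u p q with Precedes-∷⁻ p | Precedes-∷⁻ q
... | inj₁ (refl , b∈w) | inj₁ (refl , _) = Unique[x∷xs]⇒x∉xs u b∈w
... | inj₁ (refl , _) | inj₂ q′ = Unique[x∷xs]⇒x∉xs u (Precedes⇒∈ʳ q′)
... | inj₂ p′ | inj₁ (refl , _) = Unique[x∷xs]⇒x∉xs u (Precedes⇒∈ʳ p′)
... | inj₂ p′ | inj₂ q′ = Precedes-asym (Unique.tail u) p′ q′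

Precedes-irrefl : ∀ {w a} → Unique w → ¬ Precedes w a a
Precedes-irrefl u p = Precedes-asym u p p

Precedes-trans : ∀ {w a b c} → Unique w → Precedes w a b → Precedes w b c → Precedes w a c
Precedes-trans {[]} u p q = ⊥-elim (¬Precedes-[] p)
Precedes-trans {d ∷ w} u p q with Precedes-∷⁻ p | Precedes-∷⁻ q
... | inj₁ (refl , b∈w) | inj₁ (refl , _) = ⊥-elim (Unique[x∷xs]⇒x∉xs u b∈w)
... | inj₁ (refl , _) | inj₂ q′ = Precedes-head (Precedes⇒∈ʳ q′)
... | inj₂ p′ | inj₁ (refl , _) = ⊥-elim (Unique[x∷xs]⇒x∉xs u (Precedes⇒∈ʳ p′))
... | inj₂ p′ | inj₂ q′ = Precedes-∷⁺ (Precedes-trans (Unique.tail u) p′ q′)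

Precedes-total : ∀ {w a b} → a ∈ w → b ∈ w → a ≢ b → Precedes w a b ⊎ Precedes w b a
Precedes-total (here refl) (here refl) a≢b = ⊥-elim (a≢b refl)
Precedes-total (here refl) (there b∈w) _ = inj₁ (Precedes-head b∈w)
Precedes-total (there a∈w) (here refl) _ = inj₂ (Precedes-head a∈w)
Precedes-total (there a∈w) (there b∈w) a≢b with Precedes-total a∈w b∈w a≢b
... | inj₁ p = inj₁ (Precedes-∷⁺ p)
... | inj₂ p = inj₂ (Precedes-∷⁺ p)

Precedes-++⁺ˡ : ∀ {X} Y {a b} → Precedes X a b → Precedes (X ++ Y) a b
Precedes-++⁺ˡ Y (A , B , refl , b∈B) = A , B ++ Y , ++-assoc A (_ ∷ B) Y , ∈-++⁺ˡ b∈B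

Precedes-++⁺ʳ : ∀ X {Y a b} → Precedes Y a b → Precedes (X ++ Y) a b
Precedes-++⁺ʳ X (A , B , refl , b∈B) = X ++ A , B , sym (++-assoc X A _) , b∈B

Precedes-++⁺ : ∀ {X Y a b} → a ∈ X → b ∈ Y → Precedes (X ++ Y) a b
Precedes-++⁺ {X} {Y} a∈X b∈Y with ∈-∃++ a∈X
... | A , B , refl = A , B ++ Y , ++-assoc A (_ ∷ B) Y , ∈-++⁺ʳ B b∈Y

Precedes-++⁻ : ∀ X {Y a b} → Precedes (X ++ Y) a b →
               Precedes X a b ⊎ (a ∈ X × b ∈ Y) ⊎ Precedes Y a b
Precedes-++⁻ [] p = inj₂ (inj₂ p)
Precedes-++⁻ (c ∷ X) p with Precedes-∷⁻ p
... | inj₁ (refl , b∈XY) with ∈-++⁻ X b∈XY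
...   | inj₁ b∈X = inj₁ (Precedes-head b∈X)
...   | inj₂ b∈Y = inj₂ (inj₁ (here refl , b∈Y))
Precedes-++⁻ (c ∷ X) p | inj₂ p′ with Precedes-++⁻ X p′
... | inj₁ q = inj₁ (Precedes-∷⁺ q)
... | inj₂ (inj₁ (a∈X , b∈Y)) = inj₂ (inj₁ (there a∈X , b∈Y))
... | inj₂ (inj₂ q) = inj₂ (inj₂ q)

Precedes-swap⁻ : ∀ A X Y C {a b} → Precedes (A ++ X ++ Y ++ C) a b →
                 Precedes (A ++ Y ++ X ++ C) a b ⊎ (a ∈ X × b ∈ Y)
Precedes-swap⁻ A X Y C p with Precedes-++⁻ A p
... | inj₁ pA = inj₁ (Precedes-++⁺ˡ _ pA)
... | inj₂ (inj₁ (a∈A , b∈XYC)) = inj₁ (Precedes-++⁺ a∈A (∈-resp-↭ (shifts X Y) b∈XYC))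
... | inj₂ (inj₂ p′) with Precedes-++⁻ X p′
...   | inj₁ pX = inj₁ (Precedes-++⁺ʳ A (Precedes-++⁺ʳ Y (Precedes-++⁺ˡ C pX)))
...   | inj₂ (inj₁ (a∈X , b∈YC)) with ∈-++⁻ Y b∈YC
...     | inj₁ b∈Y = inj₂ (a∈X , b∈Y)
...     | inj₂ b∈C = inj₁ (Precedes-++⁺ʳ A (Precedes-++⁺ʳ Y (Precedes-++⁺ a∈X b∈C)))
Precedes-swap⁻ A X Y C p | inj₂ (inj₂ p′) | inj₂ (inj₂ p″) with Precedes-++⁻ Y p″
... | inj₁ pY = inj₁ (Precedes-++⁺ʳ A (Precedes-++⁺ˡ (X ++ C) pY))
... | inj₂ (inj₁ (a∈Y , b∈C)) = inj₁ (Precedes-++⁺ʳ A (Precedes-++⁺ a∈Y (∈-++⁺ʳ X b∈C)))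
... | inj₂ (inj₂ pC) = inj₁ (Precedes-++⁺ʳ A (Precedes-++⁺ʳ Y (Precedes-++⁺ʳ X pC)))

-- Adjacent letters

Adjacent : List ℕ → ℕ → ℕ → Set
Adjacent w x y = ∃[ A ] ∃[ C ] (w ≡ A ++ x ∷ y ∷ C)

Adjacent⇒Precedes : ∀ {w x y} → Adjacent w x y → Precedes w x y
Adjacent⇒Precedes (A , C , refl) = A , _ ∷ C , refl , here refl

Adjacent⇒≢ : ∀ {w x y} → Unique w → Adjacent w x y → x ≢ y
Adjacent⇒≢ u xy refl = Precedes-irrefl u (Adjacent⇒Precedes xy)

Adjacent⇒nothing-between : ∀ {w x y b} → Unique w → Adjacent w x y →
                           Precedes w x b → ¬ Precedes w b y
Adjacent⇒nothing-between u (A , C , refl) = go A u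
  where
  go : ∀ A {x y C b} → Unique (A ++ x ∷ y ∷ C) →
       Precedes (A ++ x ∷ y ∷ C) x b → ¬ Precedes (A ++ x ∷ y ∷ C) b y
  go [] u p q with Precedes-∷⁻ p | Precedes-∷⁻ q
  ... | _ | inj₁ (refl , _) = Precedes-irrefl u p
  ... | inj₂ p′ | _ = Unique[x∷xs]⇒x∉xs u (Precedes⇒∈ˡ p′)
  ... | inj₁ (refl , _) | inj₂ q′ with Precedes-∷⁻ q′
  ...   | inj₁ (refl , y∈C) = Unique[x∷xs]⇒x∉xs (Unique.tail u) y∈C
  ...   | inj₂ q″ = Unique[x∷xs]⇒x∉xs (Unique.tail u) (Precedes⇒∈ʳ q″)
  go (c ∷ A) u p q with Precedes-∷⁻ p | Precedes-∷⁻ q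
  ... | inj₁ (refl , _) | _ = Unique[x∷xs]⇒x∉xs u (∈-++⁺ʳ A (here refl))
  ... | inj₂ p′ | inj₁ (refl , _) = Unique[x∷xs]⇒x∉xs u (Precedes⇒∈ʳ p′)
  ... | inj₂ p′ | inj₂ q′ = go A (Unique.tail u) p′ q′

Adjacent-precedes-right : ∀ {w x y a} → Unique w → Adjacent w x y →
                          Precedes w a y → a ≢ x → Precedes w a x
Adjacent-precedes-right u xy ay a≢x
  with Precedes-total (Precedes⇒∈ˡ ay) (Precedes⇒∈ˡ (Adjacent⇒Precedes xy)) a≢x
... | inj₁ ax = ax
... | inj₂ xa = ⊥-elim (Adjacent⇒nothing-between u xy xa ay)

¬Adjacent-[] : ∀ {x y} → ¬ Adjacent [] x y
¬Adjacent-[] ([] , _ , ())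
¬Adjacent-[] (_ ∷ _ , _ , ())

¬Adjacent-[_] : ∀ c {x y} → ¬ Adjacent [ c ] x y
¬Adjacent-[ c ] ([] , _ , ())
¬Adjacent-[ c ] (_ ∷ [] , _ , ())
¬Adjacent-[ c ] (_ ∷ _ ∷ _ , _ , ())

Adjacent-∷⁺ : ∀ {c w x y} → Adjacent w x y → Adjacent (c ∷ w) x y
Adjacent-∷⁺ (A , C , refl) = _ ∷ A , C , refl

Adjacent-∷⁻ : ∀ {c w x y} → Adjacent (c ∷ w) x y → (x ≡ c × ∃[ C ] (w ≡ y ∷ C)) ⊎ Adjacent w x y
Adjacent-∷⁻ ([] , C , refl) = inj₁ (refl , C , refl)
Adjacent-∷⁻ (_ ∷ A , C , refl) = inj₂ (A , C , refl)

AdjacentPreserved : List ℕ → List ℕ → Set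
AdjacentPreserved w w′ = ∀ {x y} → Adjacent w x y → Precedes w′ x y

adjacent-preserved-or-inverted : ∀ {w′} w → Unique w → (∀ {z} → z ∈ w → z ∈ w′) →
  AdjacentPreserved w w′ ⊎ ∃[ x ] ∃[ y ] (Adjacent w x y × Precedes w′ y x)
adjacent-preserved-or-inverted [] _ _ = inj₁ (λ xy → ⊥-elim (¬Adjacent-[] xy))
adjacent-preserved-or-inverted (c ∷ []) _ _ = inj₁ (λ xy → ⊥-elim (¬Adjacent-[ c ] xy))
adjacent-preserved-or-inverted {w′} (c ∷ w@(d ∷ w₀)) u ⊆w′
  with Precedes-total (⊆w′ (here refl)) (⊆w′ (there (here refl))) (λ c≡d → Unique[x∷xs]⇒x∉xs u (here c≡d))
    | adjacent-preserved-or-inverted w (Unique.tail u) (λ z∈ → ⊆w′ (there z∈))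
... | inj₂ dc | _ = inj₂ (c , d , ([] , w₀ , refl) , dc)
... | inj₁ cd | inj₂ (x , y , xy , yx) = inj₂ (x , y , Adjacent-∷⁺ xy , yx)
... | inj₁ cd | inj₁ kept = inj₁ kept′
  where
  kept′ : AdjacentPreserved (c ∷ w) w′
  kept′ xy with Adjacent-∷⁻ xy
  ... | inj₁ (refl , C , refl) = cd
  ... | inj₂ xy′ = kept xy′

AdjacentPreserved⇒PrecedesPreserved : ∀ {w′} w → Unique w′ → AdjacentPreserved w w′ →
  ∀ {a b} → Precedes w a b → Precedes w′ a b
AdjacentPreserved⇒PrecedesPreserved [] _ _ p = ⊥-elim (¬Precedes-[] p)
AdjacentPreserved⇒PrecedesPreserved (c ∷ w) u′ kept p with Precedes-∷⁻ p
... | inj₂ p′ = AdjacentPreserved⇒PrecedesPreserved w u′ (λ xy → kept (Adjacent-∷⁺ xy)) p′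
AdjacentPreserved⇒PrecedesPreserved (c ∷ d ∷ w) u′ kept p | inj₁ (refl , here refl) =
  kept ([] , w , refl)
AdjacentPreserved⇒PrecedesPreserved (c ∷ d ∷ w) u′ kept p | inj₁ (refl , there b∈w) =
  Precedes-trans u′ (kept ([] , w , refl))
    (AdjacentPreserved⇒PrecedesPreserved (d ∷ w) u′ (λ xy → kept (Adjacent-∷⁺ xy)) (Precedes-head b∈w))

PrecedesPreserved⇒≡ : ∀ w w′ → Unique w → Unique w′ →
  (∀ {z} → z ∈ w → z ∈ w′) → (∀ {z} → z ∈ w′ → z ∈ w) →
  (∀ {a b} → Precedes w a b → Precedes w′ a b) → w ≡ w′
PrecedesPreserved⇒≡ [] [] _ _ _ _ _ = refl
PrecedesPreserved⇒≡ [] (d ∷ w′) _ _ _ ⊇ _ with ⊇ (here refl)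
... | ()
PrecedesPreserved⇒≡ (c ∷ w) [] _ _ ⊆ _ _ with ⊆ (here refl)
... | ()
PrecedesPreserved⇒≡ (c ∷ w) (d ∷ w′) u u′ ⊆ ⊇ kept with c ≟ d
... | no c≢d = ⊥-elim (d∉ (⊇ (here refl)))
  where
  d∉ : d ∉ c ∷ w
  d∉ (here d≡c) = c≢d (sym d≡c)
  d∉ (there d∈w) with Precedes-∷⁻ (kept (Precedes-head d∈w))
  ... | inj₁ (c≡d , _) = c≢d c≡d
  ... | inj₂ cd = Unique[x∷xs]⇒x∉xs u′ (Precedes⇒∈ʳ cd)
... | yes refl = cong (c ∷_) (PrecedesPreserved⇒≡ w w′ (Unique.tail u) (Unique.tail u′) ⊆′ ⊇′ kept′)
  where
  ⊆′ : ∀ {z} → z ∈ w → z ∈ w′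
  ⊆′ z∈w with ⊆ (there z∈w)
  ... | here refl = ⊥-elim (Unique[x∷xs]⇒x∉xs u z∈w)
  ... | there z∈w′ = z∈w′
  ⊇′ : ∀ {z} → z ∈ w′ → z ∈ w
  ⊇′ z∈w′ with ⊇ (there z∈w′)
  ... | here refl = ⊥-elim (Unique[x∷xs]⇒x∉xs u′ z∈w′)
  ... | there z∈w = z∈w
  kept′ : ∀ {a b} → Precedes w a b → Precedes w′ a b
  kept′ p with Precedes-∷⁻ (kept (Precedes-∷⁺ p))
  ... | inj₁ (refl , _) = ⊥-elim (Unique[x∷xs]⇒x∉xs u (Precedes⇒∈ˡ p))
  ... | inj₂ q = q

adjacent-inversion : ∀ w w′ → Unique w → Unique w′ →
  (∀ {z} → z ∈ w → z ∈ w′) → (∀ {z} → z ∈ w′ → z ∈ w) → w ≢ w′ →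
  ∃[ x ] ∃[ y ] (Adjacent w x y × Precedes w′ y x)
adjacent-inversion w w′ u u′ ⊆ ⊇ w≢w′ with adjacent-preserved-or-inverted w u ⊆
... | inj₂ inversion = inversion
... | inj₁ kept = ⊥-elim (w≢w′ (PrecedesPreserved⇒≡ w w′ u u′ ⊆ ⊇
                                 (AdjacentPreserved⇒PrecedesPreserved w u′ kept)))

-- Subwords and consecutive factors

false⇒∉S : ∀ {S : Sub} {x} → S x ≡ false → ¬ x ∈S S
false⇒∉S Sx≡false x∈S with trans (sym x∈S) Sx≡false
... | ()

restrict-∷-∈ : ∀ {S a} w → a ∈S S → restrict S (a ∷ w) ≡ a ∷ restrict S w
restrict-∷-∈ {S} {a} w a∈S with S a
restrict-∷-∈ w refl | true = refl

restrict-∷-∉ : ∀ {S a} w → S a ≡ false → restrict S (a ∷ w) ≡ restrict S w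
restrict-∷-∉ {S} {a} w a∉S with S a
restrict-∷-∉ w refl | false = refl

∈-restrict⁻ : ∀ {S z} w → z ∈ restrict S w → z ∈ w × z ∈S S
∈-restrict⁻ {S} (a ∷ w) z∈ with S a in Sa
... | false = let z∈w , z∈S = ∈-restrict⁻ w z∈ in there z∈w , z∈S
... | true with z∈
...   | here refl = here refl , Sa
...   | there z∈′ = let z∈w , z∈S = ∈-restrict⁻ w z∈′ in there z∈w , z∈S

∈-restrict⁺ : ∀ {S z} w → z ∈ w → z ∈S S → z ∈ restrict S w
∈-restrict⁺ {S} (a ∷ w) (here refl) z∈S rewrite restrict-∷-∈ {S} w z∈S = here refl
∈-restrict⁺ {S} (a ∷ w) (there z∈w) z∈S with S a
... | true = there (∈-restrict⁺ w z∈w z∈S)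
... | false = ∈-restrict⁺ w z∈w z∈S

restrict-++ : ∀ {S} X Y → restrict S (X ++ Y) ≡ restrict S X ++ restrict S Y
restrict-++ [] Y = refl
restrict-++ {S} (a ∷ X) Y with S a
... | true = cong (a ∷_) (restrict-++ X Y)
... | false = restrict-++ X Y

restrict-⊆ : ∀ {S} w → (∀ {z} → z ∈ w → z ∈S S) → restrict S w ≡ w
restrict-⊆ [] _ = refl
restrict-⊆ {S} (a ∷ w) ⊆S rewrite restrict-∷-∈ {S} w (⊆S (here refl)) =
  cong (a ∷_) (restrict-⊆ w (λ z∈w → ⊆S (there z∈w)))

restrict-disjoint : ∀ {S} w → (∀ {z} → z ∈ w → ¬ z ∈S S) → restrict S w ≡ []
restrict-disjoint [] _ = refl
restrict-disjoint {S} (a ∷ w) ∉S with S a in Sa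
... | true = ⊥-elim (∉S (here refl) Sa)
... | false = restrict-disjoint w (λ z∈w → ∉S (there z∈w))

restrict-⇔ : ∀ {S} w → (∀ {z} → z ∈S S → z ∈ w) → ∀ z → (z ∈ restrict S w) ⇔ (z ∈S S)
restrict-⇔ {S} w S⊆w z =
  mk⇔ (λ z∈ → proj₂ (∈-restrict⁻ {S} w z∈)) (λ z∈S → ∈-restrict⁺ {S} w (S⊆w z∈S) z∈S)

ConsecFactor-restrict : ∀ {S} A B C → Unique (A ++ B ++ C) → (∀ x → (x ∈ B) ⇔ (x ∈S S)) →
                        restrict S (A ++ B ++ C) ≡ B
ConsecFactor-restrict {S} A B C u B≈S
  rewrite restrict-++ {S} A (B ++ C) | restrict-++ {S} B C
        | restrict-disjoint {S} A (λ z∈A z∈S → Unique-++⇒disjoint A u z∈A (∈-++⁺ˡ (from (B≈S _) z∈S)))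
        | restrict-⊆ {S} B (λ z∈B → to (B≈S _) z∈B)
        | restrict-disjoint {S} C (λ z∈C z∈S →
            Unique-++⇒disjoint B (Unique-++⁻ʳ A u) (from (B≈S _) z∈S) z∈C)
  = ++-identityʳ B

Convex : Sub → List ℕ → Set
Convex S w = ∀ {a b c} → a ∈S S → c ∈S S → Precedes w a b → Precedes w b c → b ∈S S

Convex-++⁻ʳ : ∀ {S} X {w} → Convex S (X ++ w) → Convex S w
Convex-++⁻ʳ X convex a∈S c∈S ab bc = convex a∈S c∈S (Precedes-++⁺ʳ X ab) (Precedes-++⁺ʳ X bc)

ConsecFactor⇒Convex : ∀ {S w} → Unique w → ConsecFactor S w → Convex S w
ConsecFactor⇒Convex u (A , B , C , refl , B≈S) {a} {b} {c} a∈S c∈S ab bc with ∈-++⁻ A (Precedes⇒∈ʳ ab)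
... | inj₁ b∈A = ⊥-elim (Precedes-asym u ab (Precedes-++⁺ b∈A (∈-++⁺ˡ (from (B≈S a) a∈S))))
... | inj₂ b∈BC with ∈-++⁻ B b∈BC
...   | inj₁ b∈B = to (B≈S b) b∈B
...   | inj₂ b∈C = ⊥-elim (Precedes-asym u bc (Precedes-++⁺ʳ A (Precedes-++⁺ (from (B≈S c) c∈S) b∈C)))

Convex-prefix : ∀ {S} a R → Unique (a ∷ R) → Convex S (a ∷ R) → a ∈S S →
                ∃[ C ] (a ∷ R ≡ restrict S (a ∷ R) ++ C)
Convex-prefix {S} a [] _ _ a∈S rewrite restrict-∷-∈ {S} [] a∈S = [] , refl
Convex-prefix {S} a (b ∷ R) u convex a∈S with S b in Sb
... | true with Convex-prefix b R (Unique.tail u) (Convex-++⁻ʳ [ a ] convex) Sb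
...   | C , eq rewrite restrict-∷-∈ {S} (b ∷ R) a∈S = C , cong (a ∷_) eq
Convex-prefix {S} a (b ∷ R) u convex a∈S | false
  rewrite restrict-∷-∈ {S} (b ∷ R) a∈S | restrict-∷-∉ {S} R Sb
        | restrict-disjoint {S} R (λ z∈R z∈S →
            false⇒∉S {S} Sb (convex a∈S z∈S (Precedes-head (here refl)) (Precedes-∷⁺ (Precedes-head z∈R))))
  = b ∷ R , refl

Convex⇒ConsecFactor : ∀ {S} w → Unique w → Convex S w → (∀ {z} → z ∈S S → z ∈ w) → ConsecFactor S w
Convex⇒ConsecFactor [] _ _ S⊆w = [] , [] , [] , refl , λ z → mk⇔ (λ ()) S⊆w
Convex⇒ConsecFactor {S} (c ∷ w) u convex S⊆w with S c in Sc
... | true with Convex-prefix c w u convex Sc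
...   | C , eq = [] , restrict S (c ∷ w) , C , eq , restrict-⇔ (c ∷ w) S⊆w
Convex⇒ConsecFactor {S} (c ∷ w) u convex S⊆w | false
  with Convex⇒ConsecFactor w (Unique.tail u) (Convex-++⁻ʳ [ c ] convex) S⊆w′
  where
  S⊆w′ : ∀ {z} → z ∈S S → z ∈ w
  S⊆w′ z∈S with S⊆w z∈S
  ... | there z∈w = z∈w
  ... | here refl = ⊥-elim (false⇒∉S {S} Sc z∈S)
... | A , B , C , refl , B≈S = c ∷ A , B , C , refl , B≈S

ConsecFactor-followed-by : ∀ {S w x y} → Unique w → ConsecFactor S w →
                           Adjacent w x y → x ∈S S → ¬ y ∈S S →
                           ∃[ A ] ∃[ C ] (w ≡ A ++ restrict S w ++ y ∷ C)
ConsecFactor-followed-by {S} {w} {x} {y} u (A , B , C , refl , B≈S) xy x∈S y∉S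
  rewrite ConsecFactor-restrict A B C u B≈S with ∈-++⁻ A (Precedes⇒∈ʳ (Adjacent⇒Precedes xy))
... | inj₁ y∈A =
  ⊥-elim (Precedes-asym u (Adjacent⇒Precedes xy) (Precedes-++⁺ y∈A (∈-++⁺ˡ (from (B≈S x) x∈S))))
... | inj₂ y∈BC with ∈-++⁻ B y∈BC
...   | inj₁ y∈B = ⊥-elim (y∉S (to (B≈S y) y∈B))
...   | inj₂ y∈C with ∈-∃++ y∈C
...     | [] , C₂ , refl = A , C₂ , refl
...     | c ∷ C₁ , C₂ , refl =
  ⊥-elim (Adjacent⇒nothing-between u xy (Precedes-++⁺ʳ A (Precedes-++⁺ (from (B≈S x) x∈S) (here refl)))
                                         (Precedes-++⁺ʳ A (Precedes-++⁺ʳ B (Precedes-head (∈-++⁺ʳ C₁ (here refl))))))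

∈S-∪⁺ˡ : ∀ {S S′ : Sub} {z} → z ∈S S → z ∈S (S ∪S S′)
∈S-∪⁺ˡ {S} {S′} {z} z∈S rewrite z∈S = refl

∈S-∪⁺ʳ : ∀ {S S′ : Sub} {z} → z ∈S S′ → z ∈S (S ∪S S′)
∈S-∪⁺ʳ {S} {S′} {z} z∈S′ with S z
... | true = refl
... | false = z∈S′

∈S-∪⁻ : ∀ {S S′ : Sub} {z} → z ∈S (S ∪S S′) → z ∈S S ⊎ z ∈S S′
∈S-∪⁻ {S} {S′} {z} z∈ with S z
... | true = inj₁ refl
... | false = inj₂ z∈

-- Ornaments and elements of Θ

range-unique : ∀ n → Unique (range n)
range-unique n = map⁺ suc-injective (upTo⁺ n)

∈-range⁻ : ∀ {n z} → z ∈ range n → InN n z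
∈-range⁻ z∈ with ∈-map⁻ suc z∈
... | i , i∈ , refl = s≤s z≤n , ∈-upTo⁻ i∈

∈-range⁺ : ∀ {n z} → InN n z → z ∈ range n
∈-range⁺ {n} {suc i} (s≤s _ , i<n) = ∈-map⁺ suc (∈-upTo⁺ i<n)

InN? : ∀ n z → Dec (InN n z)
InN? n z = (1 ≤? z) ×-dec (z ≤? n)

greatest-in-chain : ∀ {A : Set} (_≼_ : A → A → Set) →
  (∀ {a} → a ≼ a) → (∀ {a b c} → a ≼ b → b ≼ c → a ≼ c) →
  {P : A → Set} → (∀ a → Dec (P a)) → (∀ {a b} → P a → P b → a ≼ b ⊎ b ≼ a) →
  ∀ xs {m} → P m → ∃[ m′ ] (P m′ × m ≼ m′ × (∀ {v} → v ∈ xs → P v → v ≼ m′))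
greatest-in-chain _≼_ refl′ _ _ _ [] {m} Pm = m , Pm , refl′ , λ ()
greatest-in-chain _≼_ refl′ trans′ P? chain (v ∷ xs) {m} Pm with P? v
... | no ¬Pv =
  let m′ , Pm′ , m≼m′ , above = greatest-in-chain _≼_ refl′ trans′ P? chain xs Pm
  in m′ , Pm′ , m≼m′ , λ { (here refl) Pv → ⊥-elim (¬Pv Pv) ; (there u∈) Pu → above u∈ Pu }
... | yes Pv with chain Pv Pm
...   | inj₁ v≼m =
  let m′ , Pm′ , m≼m′ , above = greatest-in-chain _≼_ refl′ trans′ P? chain xs Pm
  in m′ , Pm′ , m≼m′ , λ { (here refl) _ → trans′ v≼m m≼m′ ; (there u∈) Pu → above u∈ Pu }
...   | inj₂ m≼v =
  let m′ , Pm′ , v≼m′ , above = greatest-in-chain _≼_ refl′ trans′ P? chain xs Pv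
  in m′ , Pm′ , trans′ m≼v v≼m′ , λ { (here refl) _ → v≼m′ ; (there u∈) Pu → above u∈ Pu }

module Ornament {T v S} (o : OrnamentAt T v S) where

  ⊆[n] : ∀ {z} → z ∈S S → InN (nOf T) z
  ⊆[n] = proj₁ o _

  connected : ∀ {a b} → a ∈S S → b ∈S S → Star (AdjIn T S) a b
  connected = proj₁ (proj₂ o) _ _

  root∈ : v ∈S S
  root∈ = proj₁ (proj₂ (proj₂ o))

  root≤ : ∀ {z} → z ∈S S → v ≤[ T ] z
  root≤ = proj₂ (proj₂ (proj₂ o)) _

  outside-[n] : ∀ {z} → ¬ InN (nOf T) z → S z ≡ false
  outside-[n] {z} z∉[n] with S z in Sz
  ... | true = ⊥-elim (z∉[n] (⊆[n] Sz))
  ... | false = refl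

module Element {T w ϱ} (θ : InTheta T w ϱ) where

  isOrnamentation : IsOrnamentation T ϱ
  isOrnamentation = proj₁ (proj₂ θ)

  ornament : ∀ {v} → InN (nOf T) v → OrnamentAt T v (ϱ v)
  ornament = proj₁ isOrnamentation _

  laminar : ∀ {v v′} → InN (nOf T) v → InN (nOf T) v′ →
            (ϱ v ⊆S ϱ v′) ⊎ (ϱ v′ ⊆S ϱ v) ⊎ DisjointS (ϱ v) (ϱ v′)
  laminar = proj₂ isOrnamentation _ _

  factor : ∀ {v} → InN (nOf T) v → ConsecFactor (ϱ v) w
  factor = proj₂ (proj₂ θ) _

  w↭[n] : w ↭ range (nOf T)
  w↭[n] = proj₁ (proj₁ θ)

  extends : ∀ {a b} → InN (nOf T) a → InN (nOf T) b → a ≤[ T ] b → a ≢ b → Precedes w a b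
  extends = proj₂ (proj₁ θ) _ _

  unique : Unique w
  unique = Unique-resp-↭ (↭-sym w↭[n]) (range-unique (nOf T))

  ∈w⁺ : ∀ {z} → InN (nOf T) z → z ∈ w
  ∈w⁺ z∈[n] = ∈-resp-↭ (↭-sym w↭[n]) (∈-range⁺ z∈[n])

  ∈w⁻ : ∀ {z} → z ∈ w → InN (nOf T) z
  ∈w⁻ z∈w = ∈-range⁻ (∈-resp-↭ w↭[n] z∈w)

  convex : ∀ {v} → InN (nOf T) v → Convex (ϱ v) w
  convex v∈[n] = ConsecFactor⇒Convex unique (factor v∈[n])

  root∈ : ∀ {v} → InN (nOf T) v → v ∈S ϱ v
  root∈ v∈[n] = Ornament.root∈ {T} (ornament v∈[n])

  root≤ : ∀ {v z} → InN (nOf T) v → z ∈S ϱ v → v ≤[ T ] z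
  root≤ v∈[n] = Ornament.root≤ {T} (ornament v∈[n])

  ornament⊆[n] : ∀ {v z} → InN (nOf T) v → z ∈S ϱ v → InN (nOf T) z
  ornament⊆[n] v∈[n] = Ornament.⊆[n] {T} (ornament v∈[n])

ThetaLe∧¬ThetaLt⇒ThetaEq : ∀ {T w ϱ w′ ϱ′} →
  ThetaLe T w ϱ w′ ϱ′ → ¬ ThetaLt T w ϱ w′ ϱ′ → ThetaEq T w ϱ w′ ϱ′
ThetaLe∧¬ThetaLt⇒ThetaEq {T} {w} {ϱ} {w′} {ϱ′} le ¬lt with List.≡-dec _≟_ w w′
... | no w≢w′ = ⊥-elim (¬lt (le , λ eq → w≢w′ (proj₁ eq)))
... | yes w≡w′ = w≡w′ , ϱ≈ϱ′
  where
  ϱ≈ϱ′ : ϱ ≈O[ T ] ϱ′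
  ϱ≈ϱ′ v v∈[n] z with ϱ v z Bool.≟ ϱ′ v z
  ... | yes eq = eq
  ... | no neq = ⊥-elim (¬lt (le , λ eq → neq (proj₂ eq v v∈[n] z)))

ornament-grows : ∀ {T ϱ ϱ′} → IsOrnamentation T ϱ → IsOrnamentation T ϱ′ →
  ϱ ≤O[ T ] ϱ′ → ¬ ϱ ≈O[ T ] ϱ′ →
  ∃[ v ] ∃[ z ] (InN (nOf T) v × ϱ v z ≡ false × z ∈S ϱ′ v)
ornament-grows {T} {ϱ} {ϱ′} isO isO′ ϱ≤ϱ′ ϱ≉ϱ′
  with all? (λ v → all? (λ z → ϱ v z Bool.≟ ϱ′ v z) (range (nOf T))) (range (nOf T))
... | yes same = ⊥-elim (ϱ≉ϱ′ ϱ≈ϱ′)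
  where
  ϱ≈ϱ′ : ϱ ≈O[ T ] ϱ′
  ϱ≈ϱ′ v v∈[n] z with InN? (nOf T) z
  ... | yes z∈[n] = All-lookup (All-lookup same (∈-range⁺ v∈[n])) (∈-range⁺ z∈[n])
  ... | no z∉[n] = trans (Ornament.outside-[n] {T} (proj₁ isO v v∈[n]) z∉[n])
                         (sym (Ornament.outside-[n] {T} (proj₁ isO′ v v∈[n]) z∉[n]))
... | no differ with find (¬All⇒Any¬ (λ v → all? (λ z → ϱ v z Bool.≟ ϱ′ v z) (range (nOf T))) _ differ)
...   | v , v∈ , differ-at-v
  with find (¬All⇒Any¬ (λ z → ϱ v z Bool.≟ ϱ′ v z) _ differ-at-v)
...   | z , _ , ϱvz≢ϱ′vz with ϱ v z in ϱvz | ϱ′ v z in ϱ′vz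
...   | false | true = v , z , ∈-range⁻ v∈ , ϱvz , ϱ′vz
...   | false | false = ⊥-elim (ϱvz≢ϱ′vz refl)
...   | true | true = ⊥-elim (ϱvz≢ϱ′vz refl)
...   | true | false = ⊥-elim (false⇒∉S {ϱ′ v} ϱ′vz (ϱ≤ϱ′ v (∈-range⁻ v∈) z ϱvz))

_[_≔_] : Ornamentation → ℕ → Sub → Ornamentation
(ϱ [ p ≔ S ]) v with v ≟ p
... | yes _ = S
... | no _ = ϱ v

[≔]-updated : ∀ ϱ p S → (ϱ [ p ≔ S ]) p ≡ S
[≔]-updated ϱ p S with p ≟ p
... | yes _ = refl
... | no p≢p = ⊥-elim (p≢p refl)

[≔]-unchanged : ∀ ϱ {p} S {v} → v ≢ p → (ϱ [ p ≔ S ]) v ≡ ϱ v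
[≔]-unchanged ϱ {p} S {v} v≢p with v ≟ p
... | yes v≡p = ⊥-elim (v≢p v≡p)
... | no _ = refl

data Position (S P Q : Sub) : Set where
  inside-P : S ⊆S P → Position S P Q
  inside-Q : S ⊆S Q → Position S P Q
  around : P ⊆S S → Q ⊆S S → Position S P Q
  apart : DisjointS S P → DisjointS S Q → Position S P Q

Position⇒comparable-∪ : ∀ {S P Q} → Position S P Q →
  (S ⊆S (P ∪S Q)) ⊎ ((P ∪S Q) ⊆S S) ⊎ DisjointS S (P ∪S Q)
Position⇒comparable-∪ {S} {P} {Q} (inside-P S⊆P) = inj₁ (λ z z∈S → ∈S-∪⁺ˡ {P} {Q} (S⊆P z z∈S))
Position⇒comparable-∪ {S} {P} {Q} (inside-Q S⊆Q) = inj₁ (λ z z∈S → ∈S-∪⁺ʳ {P} {Q} (S⊆Q z z∈S))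
Position⇒comparable-∪ {S} {P} {Q} (around P⊆S Q⊆S) =
  inj₂ (inj₁ (λ z z∈ → [ P⊆S z , Q⊆S z ]′ (∈S-∪⁻ {P} {Q} z∈)))
Position⇒comparable-∪ {S} {P} {Q} (apart S∩P=∅ S∩Q=∅) =
  inj₂ (inj₂ (λ z z∈S z∈ → [ S∩P=∅ z z∈S , S∩Q=∅ z z∈S ]′ (∈S-∪⁻ {P} {Q} z∈)))

Convex-swap : ∀ {S P Q} A X Y C → Unique (A ++ Y ++ X ++ C) →
  (∀ z → (z ∈ X) ⇔ (z ∈S P)) → (∀ z → (z ∈ Y) ⇔ (z ∈S Q)) → DisjointS P Q → Position S P Q →
  Convex S (A ++ X ++ Y ++ C) → Convex S (A ++ Y ++ X ++ C)
Convex-swap {S} {P} {Q} A X Y C u X≈P Y≈Q P∩Q=∅ position convex {a} {b} {c} a∈S c∈S ab bc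
  with Precedes-swap⁻ A Y X C ab | Precedes-swap⁻ A Y X C bc
... | inj₁ ab′ | inj₁ bc′ = convex a∈S c∈S ab′ bc′
... | inj₂ (a∈Y , b∈X) | _ = case position
  where
  case : Position S P Q → b ∈S S
  case (inside-P S⊆P) = ⊥-elim (P∩Q=∅ a (S⊆P a a∈S) (to (Y≈Q a) a∈Y))
  case (inside-Q S⊆Q) =
    ⊥-elim (Precedes-asym u bc (Precedes-++⁺ʳ A (Precedes-++⁺ (from (Y≈Q c) (S⊆Q c c∈S)) (∈-++⁺ˡ b∈X))))
  case (around P⊆S _) = P⊆S b (to (X≈P b) b∈X)
  case (apart _ S∩Q=∅) = ⊥-elim (S∩Q=∅ a a∈S (to (Y≈Q a) a∈Y))
... | _ | inj₂ (b∈Y , c∈X) = case position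
  where
  case : Position S P Q → b ∈S S
  case (inside-P S⊆P) =
    ⊥-elim (Precedes-asym u ab (Precedes-++⁺ʳ A (Precedes-++⁺ b∈Y (∈-++⁺ˡ (from (X≈P a) (S⊆P a a∈S))))))
  case (inside-Q S⊆Q) = ⊥-elim (P∩Q=∅ c (to (X≈P c) c∈X) (S⊆Q c c∈S))
  case (around _ Q⊆S) = Q⊆S b (to (Y≈Q b) b∈Y)
  case (apart S∩P=∅ _) = ⊥-elim (S∩P=∅ c c∈S (to (X≈P c) c∈X))

-- Covers in Θ

module Cover {T w ϱ w′ ϱ′} (θ : InTheta T w ϱ) (θ′ : InTheta T w′ ϱ′)
             (cover : Covers T w ϱ w′ ϱ′) where

  open Element {T} θ
  open Element {T} θ′ using () renaming
    ( isOrnamentation to isOrnamentation′; laminar to laminar′; extends to extends′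
    ; unique to unique′; ∈w⁺ to ∈w′⁺; ∈w⁻ to ∈w′⁻; convex to convex′; root∈ to root∈′; root≤ to root≤′
    ; ornament⊆[n] to ornament⊆[n]′)

  n : ℕ
  n = nOf T

  w≤w′ : w ≤W w′
  w≤w′ = proj₁ (proj₁ (proj₁ cover))

  ϱ≤ϱ′ : ϱ ≤O[ T ] ϱ′
  ϱ≤ϱ′ = proj₂ (proj₁ (proj₁ cover))

  ϱ≤ϱ′-at : ∀ {v z} → InN n v → z ∈S ϱ v → z ∈S ϱ′ v
  ϱ≤ϱ′-at v∈[n] = ϱ≤ϱ′ _ v∈[n] _

  squeeze : ∀ {w″ ϱ″} → InTheta T w″ ϱ″ → ThetaLt T w ϱ w″ ϱ″ → ThetaLe T w″ ϱ″ w′ ϱ′ →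
            ThetaEq T w″ ϱ″ w′ ϱ′
  squeeze θ″ lt le = ThetaLe∧¬ThetaLt⇒ThetaEq {T} le (λ lt′ → proj₂ cover _ _ θ″ (lt , lt′))

  Separates : ℕ → ℕ → ℕ → Set
  Separates a b v = InN n v × a ∈S ϱ v × ¬ b ∈S ϱ v

  record LargestSeparating (a b p : ℕ) : Set where
    field
      in-range : InN n p
      contains : a ∈S ϱ p
      avoids : ¬ b ∈S ϱ p
      largest : ∀ {v} → Separates a b v → ϱ v ⊆S ϱ p

  largest-separating : ∀ {a b m} → Separates a b m → ∃[ p ] (LargestSeparating a b p × ϱ m ⊆S ϱ p)
  largest-separating {a} {b} separates-m
    with greatest-in-chain (λ u v → ϱ u ⊆S ϱ v) (λ _ z∈ → z∈) (λ u⊆v v⊆v′ z z∈ → v⊆v′ z (u⊆v z z∈))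
                           separates? nested (range n) separates-m
    where
    separates? : ∀ v → Dec (Separates a b v)
    separates? v = InN? n v ×-dec (ϱ v a Bool.≟ true) ×-dec ¬? (ϱ v b Bool.≟ true)
    nested : ∀ {u v} → Separates a b u → Separates a b v → ϱ u ⊆S ϱ v ⊎ ϱ v ⊆S ϱ u
    nested (u∈[n] , a∈u , _) (v∈[n] , a∈v , _) with laminar u∈[n] v∈[n]
    ... | inj₁ u⊆v = inj₁ u⊆v
    ... | inj₂ (inj₁ v⊆u) = inj₂ v⊆u
    ... | inj₂ (inj₂ u∩v=∅) = ⊥-elim (u∩v=∅ a a∈u a∈v)
  ... | p , (p∈[n] , a∈p , b∉p) , m⊆p , largest =
    p , record { in-range = p∈[n] ; contains = a∈p ; avoids = b∉p
               ; largest = λ separates-v → largest (∈-range⁺ (proj₁ separates-v)) separates-v } , m⊆p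

  module Separation {x y p q} (xy : Adjacent w x y)
                    (P-largest : LargestSeparating x y p) (Q-largest : LargestSeparating y x q) where

    open LargestSeparating P-largest renaming (in-range to p∈[n]; contains to x∈P; avoids to y∉P; largest to P-max)
    open LargestSeparating Q-largest renaming (in-range to q∈[n]; contains to y∈Q; avoids to x∉Q; largest to Q-max)

    P Q : Sub
    P = ϱ p
    Q = ϱ q

    x∈w : x ∈ w
    x∈w = Precedes⇒∈ˡ (Adjacent⇒Precedes xy)

    y∈w : y ∈ w
    y∈w = Precedes⇒∈ʳ (Adjacent⇒Precedes xy)

    P∩Q=∅ : DisjointS P Q
    P∩Q=∅ with laminar p∈[n] q∈[n]
    ... | inj₁ P⊆Q = ⊥-elim (x∉Q (P⊆Q x x∈P))
    ... | inj₂ (inj₁ Q⊆P) = ⊥-elim (y∉P (Q⊆P y y∈Q))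
    ... | inj₂ (inj₂ P∩Q=∅) = P∩Q=∅

    -- Q is a factor of w beginning with its root q; it contains y but not the letter x just before y.
    q≡y : q ≡ y
    q≡y with q ≟ y
    ... | yes q≡y = q≡y
    ... | no q≢y = ⊥-elim (x∉Q (convex q∈[n] (root∈ q∈[n]) y∈Q q<x (Adjacent⇒Precedes xy)))
      where
      q≢x : q ≢ x
      q≢x q≡x = x∉Q (subst (_∈S Q) q≡x (root∈ q∈[n]))
      q<x : Precedes w q x
      q<x = Adjacent-precedes-right unique xy (extends q∈[n] (∈w⁻ y∈w) (root≤ q∈[n] y∈Q) q≢y) q≢x

    q∉P : ¬ q ∈S P
    q∉P q∈P = y∉P (subst (_∈S P) q≡y q∈P)

    p≢q : p ≢ q
    p≢q p≡q = q∉P (subst (_∈S P) p≡q (root∈ p∈[n]))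

    position : ∀ {v} → InN n v → Position (ϱ v) P Q
    position {v} v∈[n] with laminar v∈[n] p∈[n]
    ... | inj₁ v⊆P = inside-P v⊆P
    ... | inj₂ (inj₁ P⊆v) with ϱ v y in vy
    ...   | false = inside-P (P-max (v∈[n] , P⊆v x x∈P , false⇒∉S {ϱ v} vy))
    ...   | true with laminar v∈[n] q∈[n]
    ...     | inj₁ v⊆Q = ⊥-elim (x∉Q (v⊆Q x (P⊆v x x∈P)))
    ...     | inj₂ (inj₁ Q⊆v) = around P⊆v Q⊆v
    ...     | inj₂ (inj₂ v∩Q=∅) = ⊥-elim (v∩Q=∅ y vy y∈Q)
    position {v} v∈[n] | inj₂ (inj₂ v∩P=∅) with laminar v∈[n] q∈[n]
    ... | inj₁ v⊆Q = inside-Q v⊆Q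
    ... | inj₂ (inj₁ Q⊆v) = inside-Q (Q-max (v∈[n] , Q⊆v y y∈Q , λ x∈v → v∩P=∅ x x∈v x∈P))
    ... | inj₂ (inj₂ v∩Q=∅) = apart v∩P=∅ v∩Q=∅

    -- The factors P and Q of w meet at the adjacent letters x, y.
    P∪Q-convex : Convex (P ∪S Q) w
    P∪Q-convex {a} {b} {c} a∈ c∈ ab bc with ∈S-∪⁻ {P} {Q} a∈ | ∈S-∪⁻ {P} {Q} c∈
    ... | inj₁ a∈P | inj₁ c∈P = ∈S-∪⁺ˡ {P} {Q} (convex p∈[n] a∈P c∈P ab bc)
    ... | inj₂ a∈Q | inj₂ c∈Q = ∈S-∪⁺ʳ {P} {Q} (convex q∈[n] a∈Q c∈Q ab bc)
    ... | inj₁ a∈P | inj₂ c∈Q with b ≟ x | b ≟ y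
    ...   | yes refl | _ = ∈S-∪⁺ˡ {P} {Q} x∈P
    ...   | no _ | yes refl = ∈S-∪⁺ʳ {P} {Q} y∈Q
    ...   | no b≢x | no b≢y with Precedes-total (Precedes⇒∈ʳ ab) x∈w b≢x
    ...     | inj₁ bx = ∈S-∪⁺ˡ {P} {Q} (convex p∈[n] a∈P x∈P ab bx)
    ...     | inj₂ xb with Precedes-total (Precedes⇒∈ʳ ab) y∈w b≢y
    ...       | inj₁ by = ⊥-elim (Adjacent⇒nothing-between unique xy xb by)
    ...       | inj₂ yb = ∈S-∪⁺ʳ {P} {Q} (convex q∈[n] y∈Q c∈Q yb bc)
    P∪Q-convex {a} {b} {c} a∈ c∈ ab bc | inj₂ a∈Q | inj₁ c∈P = ⊥-elim Q-before-P
      where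
      Q-before-P : ⊥
      Q-before-P with Precedes-total (Precedes⇒∈ˡ ab) x∈w (λ a≡x → x∉Q (subst (_∈S Q) a≡x a∈Q))
      ... | inj₁ ax = x∉Q (convex q∈[n] a∈Q y∈Q ax (Adjacent⇒Precedes xy))
      ... | inj₂ xa with Precedes-total (Precedes⇒∈ʳ bc) y∈w (λ c≡y → y∉P (subst (_∈S P) c≡y c∈P))
      ...   | inj₁ cy = Adjacent⇒nothing-between unique xy (Precedes-trans unique xa (Precedes-trans unique ab bc)) cy
      ...   | inj₂ yc = y∉P (convex p∈[n] x∈P c∈P (Adjacent⇒Precedes xy) yc)

    P∪Q : Sub
    P∪Q = P ∪S Q

    -- If q ∈ ϱ′ p, then ϱ with Q merged into P lies between (w, ϱ) and (w′, ϱ′).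
    module Merge (q∈P′ : q ∈S ϱ′ p) where

      p≤q : p ≤[ T ] q
      p≤q = root≤′ p∈[n] q∈P′

      parent-of-q : ∃[ g ] (p ≤[ T ] g × Parent T g q)
      parent-of-q = ≤T-parent-of-last T p≤q p≢q

      g : ℕ
      g = proj₁ parent-of-q

      p≤g : p ≤[ T ] g
      p≤g = proj₁ (proj₂ parent-of-q)

      g⋖q : Parent T g q
      g⋖q = proj₂ (proj₂ parent-of-q)

      g∈[n] : InN n g
      g∈[n] = ≤-trans (proj₁ p∈[n]) (≤T⇒≤ T p≤g) , ≤-trans (<⇒≤ (parent⇒< T g⋖q)) (proj₂ q∈[n])

      -- The parent g of q = y precedes y in w, so it lies in the factor P between p and x.
      g∈P : g ∈S P
      g∈P with g ≟ x | p ≟ g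
      ... | yes g≡x | _ = subst (_∈S P) (sym g≡x) x∈P
      ... | no _ | yes p≡g = subst (_∈S P) p≡g (root∈ p∈[n])
      ... | no g≢x | no p≢g = convex p∈[n] (root∈ p∈[n]) x∈P (extends p∈[n] g∈[n] p≤g p≢g) g<x
        where
        g<y : Precedes w g y
        g<y = subst (Precedes w g) q≡y (extends g∈[n] q∈[n] (g⋖q ◅ ε) (<⇒≢ (parent⇒< T g⋖q)))
        g<x : Precedes w g x
        g<x = Adjacent-precedes-right unique xy g<y g≢x

      P∪Q-ornament : OrnamentAt T p P∪Q
      P∪Q-ornament = ⊆[n] , connected , ∈S-∪⁺ˡ {P} {Q} (root∈ p∈[n]) , p≤
        where
        ⊆[n] : ∀ z → z ∈S P∪Q → InN n z
        ⊆[n] z z∈ = [ ornament⊆[n] p∈[n] , ornament⊆[n] q∈[n] ]′ (∈S-∪⁻ {P} {Q} z∈)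
        liftP : ∀ {a b} → Star (AdjIn T P) a b → Star (AdjIn T P∪Q) a b
        liftP = Star.map (λ (a∈ , b∈ , e) → ∈S-∪⁺ˡ {P} {Q} a∈ , ∈S-∪⁺ˡ {P} {Q} b∈ , e)
        liftQ : ∀ {a b} → Star (AdjIn T Q) a b → Star (AdjIn T P∪Q) a b
        liftQ = Star.map (λ (a∈ , b∈ , e) → ∈S-∪⁺ʳ {P} {Q} a∈ , ∈S-∪⁺ʳ {P} {Q} b∈ , e)
        g∈ : g ∈S P∪Q
        g∈ = ∈S-∪⁺ˡ {P} {Q} g∈P
        q∈ : q ∈S P∪Q
        q∈ = ∈S-∪⁺ʳ {P} {Q} (root∈ q∈[n])
        connectedP : ∀ {a b} → a ∈S P → b ∈S P → Star (AdjIn T P) a b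
        connectedP = Ornament.connected {T} (ornament p∈[n])
        connectedQ : ∀ {a b} → a ∈S Q → b ∈S Q → Star (AdjIn T Q) a b
        connectedQ = Ornament.connected {T} (ornament q∈[n])
        connected : ∀ a b → a ∈S P∪Q → b ∈S P∪Q → Star (AdjIn T P∪Q) a b
        connected a b a∈ b∈ with ∈S-∪⁻ {P} {Q} a∈ | ∈S-∪⁻ {P} {Q} b∈
        ... | inj₁ a∈P | inj₁ b∈P = liftP (connectedP a∈P b∈P)
        ... | inj₂ a∈Q | inj₂ b∈Q = liftQ (connectedQ a∈Q b∈Q)
        ... | inj₁ a∈P | inj₂ b∈Q =
          liftP (connectedP a∈P g∈P) ◅◅ ((g∈ , q∈ , inj₁ g⋖q) ◅ liftQ (connectedQ (root∈ q∈[n]) b∈Q))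
        ... | inj₂ a∈Q | inj₁ b∈P =
          liftQ (connectedQ a∈Q (root∈ q∈[n])) ◅◅ ((q∈ , g∈ , inj₂ g⋖q) ◅ liftP (connectedP g∈P b∈P))
        p≤ : ∀ z → z ∈S P∪Q → p ≤[ T ] z
        p≤ z z∈ = [ root≤ p∈[n] , (λ z∈Q → p≤q ◅◅ root≤ q∈[n] z∈Q) ]′ (∈S-∪⁻ {P} {Q} z∈)

      merged : Ornamentation
      merged = ϱ [ p ≔ P∪Q ]

      merged-isOrnamentation : IsOrnamentation T merged
      merged-isOrnamentation = merged-ornament , merged-laminar
        where
        merged-ornament : ∀ v → InN n v → OrnamentAt T v (merged v)
        merged-ornament v v∈[n] with v ≟ p
        ... | yes refl = P∪Q-ornament
        ... | no _ = ornament v∈[n]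
        merged-laminar : ∀ v v′ → InN n v → InN n v′ →
          (merged v ⊆S merged v′) ⊎ (merged v′ ⊆S merged v) ⊎ DisjointS (merged v) (merged v′)
        merged-laminar v v′ v∈[n] v′∈[n] with v ≟ p | v′ ≟ p
        ... | yes refl | yes refl = inj₁ (λ _ z∈ → z∈)
        ... | no _ | no _ = laminar v∈[n] v′∈[n]
        ... | no _ | yes refl = Position⇒comparable-∪ (position v∈[n])
        ... | yes refl | no _ with Position⇒comparable-∪ (position v′∈[n])
        ...   | inj₁ v′⊆ = inj₂ (inj₁ v′⊆)
        ...   | inj₂ (inj₁ ⊆v′) = inj₁ ⊆v′
        ...   | inj₂ (inj₂ v′∩=∅) = inj₂ (inj₂ (λ z z∈ z∈v′ → v′∩=∅ z z∈v′ z∈))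

      merged-factor : ∀ v → InN n v → ConsecFactor (merged v) w
      merged-factor v v∈[n] with v ≟ p
      ... | yes refl =
        Convex⇒ConsecFactor w unique P∪Q-convex (λ z∈ → ∈w⁺ (Ornament.⊆[n] {T} P∪Q-ornament z∈))
      ... | no _ = factor v∈[n]

      ϱ<merged : ThetaLt T w ϱ w merged
      ϱ<merged = ((λ _ _ inv → inv) , ϱ≤merged) , λ (_ , ϱ≈merged) →
        q∉P (trans (ϱ≈merged p p∈[n] q)
                   (trans (cong (λ S → S q) ([≔]-updated ϱ p P∪Q)) (∈S-∪⁺ʳ {P} {Q} (root∈ q∈[n]))))
        where
        ϱ≤merged : ϱ ≤O[ T ] merged
        ϱ≤merged v v∈[n] z z∈ with v ≟ p
        ... | yes refl = ∈S-∪⁺ˡ {P} {Q} z∈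
        ... | no _ = z∈

      Q⊆P′ : Q ⊆S ϱ′ p
      Q⊆P′ with laminar′ p∈[n] q∈[n]
      ... | inj₁ P′⊆Q′ =
        ⊥-elim (p≢q (≤T-antisym T p≤q (root≤′ q∈[n] (P′⊆Q′ p (ϱ≤ϱ′-at p∈[n] (root∈ p∈[n]))))))
      ... | inj₂ (inj₁ Q′⊆P′) = λ z z∈Q → Q′⊆P′ z (ϱ≤ϱ′-at q∈[n] z∈Q)
      ... | inj₂ (inj₂ P′∩Q′=∅) = ⊥-elim (P′∩Q′=∅ q q∈P′ (root∈′ q∈[n]))

      merged≤ϱ′ : ThetaLe T w merged w′ ϱ′
      merged≤ϱ′ = w≤w′ , merged≤
        where
        merged≤ : merged ≤O[ T ] ϱ′
        merged≤ v v∈[n] z z∈ with v ≟ p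
        ... | yes refl = [ ϱ≤ϱ′-at p∈[n] , Q⊆P′ z ]′ (∈S-∪⁻ {P} {Q} z∈)
        ... | no _ = ϱ≤ϱ′-at v∈[n] z∈

      merged≡ϱ′ : ThetaEq T w merged w′ ϱ′
      merged≡ϱ′ = squeeze (proj₁ θ , merged-isOrnamentation , merged-factor) ϱ<merged merged≤ϱ′

      associahedron-move : AssocMove T w ϱ w′ ϱ′
      associahedron-move with ConsecFactor-followed-by unique (factor p∈[n]) xy x∈P y∉P
      ... | A , C , w≡ =
        proj₁ merged≡ϱ′ , p , p∈[n] ,
        (λ v v∈[n] v≢p z →
          trans (cong (λ S → S z) (sym ([≔]-unchanged ϱ P∪Q v≢p))) (proj₂ merged≡ϱ′ v v∈[n] z)) ,
        A , C , q , subst (λ u → w ≡ A ++ restrict P w ++ u ∷ C) (sym q≡y) w≡ ,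
        (λ z → trans (sym (proj₂ merged≡ϱ′ p p∈[n] z)) (cong (λ S → S z) ([≔]-updated ϱ p P∪Q)))

    P-then-Q : ∃[ A ] ∃[ C ] (w ≡ A ++ restrict P w ++ restrict Q w ++ C)
    P-then-Q with ConsecFactor-followed-by unique (factor p∈[n]) xy x∈P y∉P
    ... | A , C , w≡ with Convex-prefix y C (Unique-++⁻ʳ (A ++ restrict P w) unique-split)
                                         (Convex-++⁻ʳ (A ++ restrict P w) convex-split) y∈Q
      where
      unique-split : Unique ((A ++ restrict P w) ++ y ∷ C)
      unique-split = subst Unique (trans w≡ (sym (++-assoc A _ _))) unique
      convex-split : Convex Q ((A ++ restrict P w) ++ y ∷ C)
      convex-split = subst (Convex Q) (trans w≡ (sym (++-assoc A _ _))) (convex q∈[n])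
    ... | C′ , y∷C≡ =
      A , C′ , trans w≡ (cong (λ R → A ++ restrict P w ++ R) (trans y∷C≡ (cong (_++ C′) (sym restrict-Q))))
      where
      A∩Q=∅ : ∀ {z} → z ∈ A → ¬ z ∈S Q
      A∩Q=∅ {z} z∈A z∈Q = x∉Q (convex q∈[n] z∈Q y∈Q z<x (Adjacent⇒Precedes xy))
        where
        z<x : Precedes w z x
        z<x = subst (λ v → Precedes v _ x) (sym w≡)
                    (Precedes-++⁺ z∈A (∈-++⁺ˡ (∈-restrict⁺ {P} w x∈w x∈P)))
      P∩Q=∅′ : ∀ {z} → z ∈ restrict P w → ¬ z ∈S Q
      P∩Q=∅′ z∈ = P∩Q=∅ _ (proj₂ (∈-restrict⁻ {P} w z∈))
      restrict-Q : restrict Q w ≡ restrict Q (y ∷ C)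
      restrict-Q = begin
        restrict Q w                                       ≡⟨ cong (restrict Q) w≡ ⟩
        restrict Q (A ++ restrict P w ++ y ∷ C)            ≡⟨ restrict-++ A _ ⟩
        restrict Q A ++ restrict Q (restrict P w ++ y ∷ C) ≡⟨ cong₂ _++_ (restrict-disjoint A A∩Q=∅)
                                                                          (restrict-++ (restrict P w) _) ⟩
        restrict Q (restrict P w) ++ restrict Q (y ∷ C)    ≡⟨ cong (_++ _) (restrict-disjoint (restrict P w) P∩Q=∅′) ⟩
        restrict Q (y ∷ C)                                 ∎
        where open ≡-Reasoning

    -- If q ∉ ϱ′ p, then w with the factors P and Q swapped lies between (w, ϱ) and (w′, ϱ′).
    module Swap (q∉P′ : ¬ q ∈S ϱ′ p) (y<′x : Precedes w′ y x)
                (A C : List ℕ) (w≡ : w ≡ A ++ restrict P w ++ restrict Q w ++ C) where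

      X Y swapped : List ℕ
      X = restrict P w
      Y = restrict Q w
      swapped = A ++ Y ++ X ++ C

      X≈P : ∀ z → (z ∈ X) ⇔ (z ∈S P)
      X≈P = restrict-⇔ w (λ z∈P → ∈w⁺ (ornament⊆[n] p∈[n] z∈P))

      Y≈Q : ∀ z → (z ∈ Y) ⇔ (z ∈S Q)
      Y≈Q = restrict-⇔ w (λ z∈Q → ∈w⁺ (ornament⊆[n] q∈[n] z∈Q))

      x∈P′ : x ∈S ϱ′ p
      x∈P′ = ϱ≤ϱ′-at p∈[n] x∈P

      y∈Q′ : y ∈S ϱ′ q
      y∈Q′ = ϱ≤ϱ′-at q∈[n] y∈Q

      P-before-Q : ∀ {a b} → a ∈S P → b ∈S Q → Precedes w a b
      P-before-Q {a} {b} a∈P b∈Q = subst (λ v → Precedes v a b) (sym w≡)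
        (Precedes-++⁺ʳ A (Precedes-++⁺ (from (X≈P a) a∈P) (∈-++⁺ˡ (from (Y≈Q b) b∈Q))))

      P′∩Q′=∅ : DisjointS (ϱ′ p) (ϱ′ q)
      P′∩Q′=∅ with laminar′ p∈[n] q∈[n]
      ... | inj₁ P′⊆Q′ = ⊥-elim (Precedes-asym unique (P-before-Q (root∈ p∈[n]) (root∈ q∈[n]))
              (extends q∈[n] p∈[n] (root≤′ q∈[n] (P′⊆Q′ p (ϱ≤ϱ′-at p∈[n] (root∈ p∈[n]))))
                       (λ q≡p → p≢q (sym q≡p))))
      ... | inj₂ (inj₁ Q′⊆P′) = ⊥-elim (q∉P′ (Q′⊆P′ q (root∈′ q∈[n])))
      ... | inj₂ (inj₂ P′∩Q′=∅) = P′∩Q′=∅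

      -- ϱ′ p and ϱ′ q are disjoint factors of w′, and y ∈ ϱ′ q precedes x ∈ ϱ′ p in w′.
      Q′-before-P′ : ∀ {a b} → a ∈S ϱ′ p → b ∈S ϱ′ q → Precedes w′ b a
      Q′-before-P′ {a} {b} a∈P′ b∈Q′
        with Precedes-total (∈w′⁺ (ornament⊆[n]′ p∈[n] a∈P′)) (∈w′⁺ (ornament⊆[n]′ q∈[n] b∈Q′))
                            (λ a≡b → P′∩Q′=∅ a a∈P′ (subst (_∈S ϱ′ q) (sym a≡b) b∈Q′))
      ... | inj₂ ba = ba
      ... | inj₁ ab with b ≟ x
      ...   | yes refl = ⊥-elim (P′∩Q′=∅ b x∈P′ b∈Q′)
      ...   | no b≢x
        with Precedes-total (∈w′⁺ (ornament⊆[n]′ q∈[n] b∈Q′)) (∈w′⁺ (ornament⊆[n]′ p∈[n] x∈P′)) b≢x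
      ...     | inj₁ bx = ⊥-elim (P′∩Q′=∅ b (convex′ p∈[n] a∈P′ x∈P′ ab bx) b∈Q′)
      ...     | inj₂ xb = ⊥-elim (P′∩Q′=∅ x x∈P′ (convex′ q∈[n] y∈Q′ b∈Q′ y<′x xb))

      -- Otherwise (b, a) would be an inversion of w, hence of w′, which Q′-before-P′ forbids.
      P<Q : ∀ {a b} → a ∈S P → b ∈S Q → a < b
      P<Q {a} {b} a∈P b∈Q with <-cmp a b
      ... | tri< a<b _ _ = a<b
      ... | tri≈ _ refl _ = ⊥-elim (P∩Q=∅ a a∈P b∈Q)
      ... | tri> _ _ b<a = ⊥-elim (Precedes-asym unique′ (proj₂ (w≤w′ b a (b<a , P-before-Q a∈P b∈Q)))
                                                   (Q′-before-P′ (ϱ≤ϱ′-at p∈[n] a∈P) (ϱ≤ϱ′-at q∈[n] b∈Q)))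

      P≰Q : ∀ {a b} → a ∈S P → b ∈S Q → ¬ a ≤[ T ] b
      P≰Q a∈P b∈Q a≤b = Precedes-asym unique′
        (extends′ (ornament⊆[n] p∈[n] a∈P) (ornament⊆[n] q∈[n] b∈Q) a≤b (λ { refl → P∩Q=∅ _ a∈P b∈Q }))
        (Q′-before-P′ (ϱ≤ϱ′-at p∈[n] a∈P) (ϱ≤ϱ′-at q∈[n] b∈Q))

      Q≰P : ∀ {a b} → a ∈S P → b ∈S Q → ¬ b ≤[ T ] a
      Q≰P a∈P b∈Q b≤a = Precedes-asym unique (P-before-Q a∈P b∈Q)
        (extends (ornament⊆[n] q∈[n] b∈Q) (ornament⊆[n] p∈[n] a∈P) b≤a (λ { refl → P∩Q=∅ _ a∈P b∈Q }))

      split : ∀ {a b} → Precedes w a b → Precedes (A ++ X ++ Y ++ C) a b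
      split {a} {b} = subst (λ v → Precedes v a b) w≡

      swapped↭w : swapped ↭ w
      swapped↭w = subst (swapped ↭_) (sym w≡) (++⁺ˡ A (shifts Y X))

      swapped∈Θ : InTheta T swapped ϱ
      swapped∈Θ = (swapped↭[n] , extends″) , isOrnamentation , factor″
        where
        swapped↭[n] : swapped ↭ range n
        swapped↭[n] = ↭-trans swapped↭w w↭[n]
        unique″ : Unique swapped
        unique″ = Unique-resp-↭ (↭-sym swapped↭[n]) (range-unique n)
        extends″ : ∀ a b → InN n a → InN n b → a ≤[ T ] b → a ≢ b → Precedes swapped a b
        extends″ a b a∈[n] b∈[n] a≤b a≢b with Precedes-swap⁻ A X Y C (split (extends a∈[n] b∈[n] a≤b a≢b))
        ... | inj₁ ab = ab
        ... | inj₂ (a∈X , b∈Y) = ⊥-elim (P≰Q (to (X≈P a) a∈X) (to (Y≈Q b) b∈Y) a≤b)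
        factor″ : ∀ v → InN n v → ConsecFactor (ϱ v) swapped
        factor″ v v∈[n] = Convex⇒ConsecFactor swapped unique″
          (Convex-swap A X Y C unique″ X≈P Y≈Q P∩Q=∅ (position v∈[n]) (subst (Convex (ϱ v)) w≡ (convex v∈[n])))
          (λ z∈ → ∈-resp-↭ (↭-sym swapped↭w) (∈w⁺ (ornament⊆[n] v∈[n] z∈)))

      w<swapped : ThetaLt T w ϱ swapped ϱ
      w<swapped = (w≤swapped , λ _ _ _ z∈ → z∈) , λ (w≡swapped , _) →
        Precedes-asym unique (Adjacent⇒Precedes xy)
          (subst (λ v → Precedes v y x) (sym w≡swapped)
                 (Precedes-++⁺ʳ A (Precedes-++⁺ (from (Y≈Q y) y∈Q) (∈-++⁺ˡ (from (X≈P x) x∈P)))))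
        where
        w≤swapped : w ≤W swapped
        w≤swapped i j (i<j , j<i) with Precedes-swap⁻ A X Y C (split j<i)
        ... | inj₁ ji = i<j , ji
        ... | inj₂ (j∈X , i∈Y) = ⊥-elim (<-asym i<j (P<Q (to (X≈P j) j∈X) (to (Y≈Q i) i∈Y)))

      swapped≤w′ : ThetaLe T swapped ϱ w′ ϱ′
      swapped≤w′ = swapped≤ , ϱ≤ϱ′
        where
        swapped≤ : swapped ≤W w′
        swapped≤ i j (i<j , j<i) with Precedes-swap⁻ A Y X C j<i
        ... | inj₁ ji = w≤w′ i j (i<j , subst (λ v → Precedes v j i) (sym w≡) ji)
        ... | inj₂ (j∈Y , i∈X) =
          i<j , Q′-before-P′ (ϱ≤ϱ′-at p∈[n] (to (X≈P i) i∈X)) (ϱ≤ϱ′-at q∈[n] (to (Y≈Q j) j∈Y))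

      swapped≡w′ : ThetaEq T swapped ϱ w′ ϱ′
      swapped≡w′ = squeeze swapped∈Θ w<swapped swapped≤w′

      permutohedron-move : PermMove T w ϱ w′ ϱ′
      permutohedron-move =
        proj₂ swapped≡w′ , p , q , p∈[n] , q∈[n] ,
        P≰Q (root∈ p∈[n]) (root∈ q∈[n]) , Q≰P (root∈ p∈[n]) (root∈ q∈[n]) ,
        (λ _ _ → P<Q) , A , C , w≡ , sym (proj₁ swapped≡w′)

  adjacent-∈[n]ˡ : ∀ {x y} → Adjacent w x y → InN n x
  adjacent-∈[n]ˡ xy = ∈w⁻ (Precedes⇒∈ˡ (Adjacent⇒Precedes xy))

  adjacent-∈[n]ʳ : ∀ {x y} → Adjacent w x y → InN n y
  adjacent-∈[n]ʳ xy = ∈w⁻ (Precedes⇒∈ʳ (Adjacent⇒Precedes xy))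

  largest-separating-right : ∀ {x y} → Adjacent w x y → ∃[ q ] LargestSeparating y x q
  largest-separating-right {x} {y} xy =
    let q , Q-largest , _ = largest-separating (y∈[n] , root∈ y∈[n] , x∉ϱy) in q , Q-largest
    where
    y∈[n] : InN n y
    y∈[n] = adjacent-∈[n]ʳ xy
    x∉ϱy : ¬ x ∈S ϱ y
    x∉ϱy x∈ϱy = Precedes-asym unique (Adjacent⇒Precedes xy)
      (extends y∈[n] (adjacent-∈[n]ˡ xy) (root≤ y∈[n] x∈ϱy) (λ y≡x → Adjacent⇒≢ unique xy (sym y≡x)))

  word-changes : w ≢ w′ → PermMove T w ϱ w′ ϱ′ ⊎ AssocMove T w ϱ w′ ϱ′
  word-changes w≢w′
    with adjacent-inversion w w′ unique unique′ (λ z∈ → ∈w′⁺ (∈w⁻ z∈)) (λ z∈ → ∈w⁺ (∈w′⁻ z∈)) w≢w′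
  ... | x , y , xy , y<′x
    with largest-separating (adjacent-∈[n]ˡ xy , root∈ (adjacent-∈[n]ˡ xy) , y∉ϱx) | largest-separating-right xy
    where
    y∉ϱx : ¬ y ∈S ϱ x
    y∉ϱx y∈ϱx = Precedes-asym unique′ y<′x
      (extends′ (adjacent-∈[n]ˡ xy) (adjacent-∈[n]ʳ xy) (root≤ (adjacent-∈[n]ˡ xy) y∈ϱx) (Adjacent⇒≢ unique xy))
  ... | p , P-largest , _ | q , Q-largest with ϱ′ p q in q∈P′
  ...   | true = inj₂ (Separation.Merge.associahedron-move xy P-largest Q-largest q∈P′)
  ...   | false with Separation.P-then-Q xy P-largest Q-largest
  ...     | A , C , w≡ = inj₁ (Separation.Swap.permutohedron-move xy P-largest Q-largest
                                 (false⇒∉S {ϱ′ p} q∈P′) y<′x A C w≡)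

  new-letter-after-factor : ∀ {v z A B C} → InN n v → w ≡ A ++ B ++ C →
    (∀ z → (z ∈ B) ⇔ (z ∈S ϱ v)) → ¬ z ∈S ϱ v → z ∈S ϱ′ v → z ∈ C
  new-letter-after-factor {v} {z} {A} {B} v∈[n] w≡ B≈V z∉V z∈V′
    with ∈-++⁻ A (subst (z ∈_) w≡ (∈w⁺ z∈[n]))
    where
    z∈[n] : InN n z
    z∈[n] = ornament⊆[n]′ v∈[n] z∈V′
  ... | inj₁ z∈A =
    ⊥-elim (Precedes-asym unique v<z (subst (λ u → Precedes u z v) (sym w≡) (Precedes-++⁺ z∈A (∈-++⁺ˡ v∈B))))
    where
    v∈B : v ∈ B
    v∈B = from (B≈V v) (root∈ v∈[n])
    v<z : Precedes w v z
    v<z = extends v∈[n] (ornament⊆[n]′ v∈[n] z∈V′) (root≤′ v∈[n] z∈V′) (λ { refl → z∉V (root∈ v∈[n]) })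
  ... | inj₂ z∈BC with ∈-++⁻ B z∈BC
  ...   | inj₁ z∈B = ⊥-elim (z∉V (to (B≈V z) z∈B))
  ...   | inj₂ z∈C = z∈C

  -- Some ornament ϱ v gains a letter z; by convexity in w′ = w it also gains the letter c right after its factor.
  grown-factor : w ≡ w′ → ∃[ v ] ∃[ A ] ∃[ B ] ∃[ c ] ∃[ C ]
    (InN n v × w ≡ A ++ B ++ c ∷ C × (∀ z → (z ∈ B) ⇔ (z ∈S ϱ v)) × c ∈S ϱ′ v)
  grown-factor w≡w′
    with ornament-grows {T} isOrnamentation isOrnamentation′ ϱ≤ϱ′
                        (λ ϱ≈ϱ′ → proj₂ (proj₁ cover) (w≡w′ , ϱ≈ϱ′))
  ... | v , z , v∈[n] , z∉V , z∈V′ with factor v∈[n]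
  ... | A , B , C , w≡ , B≈V
    with new-letter-after-factor {A = A} {B = B} {C = C} v∈[n] w≡ B≈V (false⇒∉S {ϱ v} z∉V) z∈V′
  ...   | here refl = v , A , B , z , _ , v∈[n] , w≡ , B≈V , z∈V′
  ...   | there z∈C₁ = v , A , B , _ , _ , v∈[n] , w≡ , B≈V ,
          convex′ v∈[n] (root∈′ v∈[n]) z∈V′
            (in-w′ (Precedes-++⁺ʳ A (Precedes-++⁺ (from (B≈V v) (root∈ v∈[n])) (here refl))))
            (in-w′ (Precedes-++⁺ʳ A (Precedes-++⁺ʳ B (Precedes-head z∈C₁))))
    where
    in-w′ : ∀ {a b} → Precedes (A ++ B ++ C) a b → Precedes w′ a b
    in-w′ {a} {b} = subst (λ u → Precedes u a b) (trans (sym w≡) w≡w′)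

  grown-factor-boundary : w ≡ w′ → ∃[ v ] ∃[ x ] ∃[ c ]
    (InN n v × Adjacent w x c × x ∈S ϱ v × ¬ c ∈S ϱ v × c ∈S ϱ′ v)
  grown-factor-boundary w≡w′ with grown-factor w≡w′
  ... | v , A , B , c , C , v∈[n] , w≡ , B≈V , c∈V′ with initLast B
  ...   | [] with from (B≈V v) (root∈ v∈[n])
  ...     | ()
  grown-factor-boundary w≡w′ | v , A , _ , c , C , v∈[n] , w≡ , B≈V , c∈V′ | B ∷ʳ′ x =
    v , x , c , v∈[n] , xc , to (B≈V x) (∈-++⁺ʳ B (here refl)) , c∉V , c∈V′
    where
    xc : Adjacent w x c
    xc = A ++ B , C , trans w≡ (trans (cong (A ++_) (++-assoc B [ x ] (c ∷ C))) (sym (++-assoc A B (x ∷ c ∷ C))))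
    c∉V : ¬ c ∈S ϱ v
    c∉V c∈V =
      Unique-++⇒disjoint (B ∷ʳ x) (Unique-++⁻ʳ A (subst Unique w≡ unique)) (from (B≈V c) c∈V) (here refl)

  word-fixed : w ≡ w′ → AssocMove T w ϱ w′ ϱ′
  word-fixed w≡w′ with grown-factor-boundary w≡w′
  ... | v , x , c , v∈[n] , xc , x∈V , c∉V , c∈V′
    with largest-separating (v∈[n] , x∈V , c∉V) | largest-separating-right xc
  ... | p , P-largest , V⊆P | q , Q-largest =
    Separation.Merge.associahedron-move xc P-largest Q-largest
      (subst (_∈S ϱ′ p) (sym (Separation.q≡y xc P-largest Q-largest)) c∈P′)
    where
    p∈[n] : InN n p
    p∈[n] = LargestSeparating.in-range P-largest
    v∈P′ : v ∈S ϱ′ p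
    v∈P′ = ϱ≤ϱ′-at p∈[n] (V⊆P v (root∈ v∈[n]))
    c∈P′ : c ∈S ϱ′ p
    c∈P′ with laminar′ p∈[n] v∈[n]
    ... | inj₁ P′⊆V′ = subst (λ u → c ∈S ϱ′ u)
            (≤T-antisym T (root≤′ v∈[n] (P′⊆V′ p (root∈′ p∈[n]))) (root≤ p∈[n] (V⊆P v (root∈ v∈[n]))))
            c∈V′
    ... | inj₂ (inj₁ V′⊆P′) = V′⊆P′ c c∈V′
    ... | inj₂ (inj₂ P′∩V′=∅) = ⊥-elim (P′∩V′=∅ v v∈P′ (root∈′ v∈[n]))

lemma3p4 : (T : PTree) (w : List ℕ) (ϱ : Ornamentation) (w' : List ℕ) (ϱ' : Ornamentation) →
    InTheta T w ϱ → InTheta T w' ϱ' → Covers T w ϱ w' ϱ' →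
    PermMove T w ϱ w' ϱ' ⊎ AssocMove T w ϱ w' ϱ'
lemma3p4 T w ϱ w′ ϱ′ θ θ′ cover with List.≡-dec _≟_ w w′
... | yes w≡w′ = inj₂ (Cover.word-fixed {T} θ θ′ cover w≡w′)
... | no w≢w′ = Cover.word-changes {T} θ θ′ cover w≢w′
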